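{- For integers $N\ge 1$ and $n\ge 1$, $$c_{N,n}=(-1)^n n!\sum_{k=1}^n\binom{n+1}{k+1}\frac{(-N)^k\,k!}{(n+Nk)!}\begin{bmatrix}n+Nk\\ k\end{bmatrix}_{\ge N}.$$
   Context: The hypergeometric Cauchy numbers $c_{N,n}$ are defined by $\frac{1}{{}_2F_1(1,N;N+1;-x)}=\sum_{n=0}^\infty c_{N,n}\frac{x^n}{n!}$, where ${}_2F_1(a,b;c;z)=\sum_{n=0}^\infty\frac{(a)^{(n)}(b)^{(n)}}{(c)^{(n)}}\frac{z^n}{n!}$ with $(a)^{(n)}=a(a+1)\cdots(a+n-1)$, $(a)^{(0)}=1$. For $m\ge1$, the associated Stirling numbers of the first kind $\begin{bmatrix}n\\ k\end{bmatrix}_{\ge m}$ are defined by $\frac{(-\log(1-x)-F_{m-1}(x))^k}{k!}=\sum_{n=0}^\infty\begin{bmatrix}n\\ k\end{bmatrix}_{\ge m}\frac{x^n}{n!}$, where $F_0(x)=0$ and $F_m(x)=\sum_{j=1}^m\frac{x^j}{j}$ for $m\ge1$. -}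

module Defs where

open import Data.Nat as ℕ using (ℕ; zero; suc; NonZero; _≤ᵇ_)
open import Data.Nat.Properties using (_!≢0; m*n≢0)
open import Data.Integer as ℤ using (ℤ; +_)
open import Data.Rational as ℚ using (ℚ; 0ℚ; 1ℚ; _+_; _*_; -_; _/_)
open import Data.Bool using (if_then_else_)
open import Data.List using (List; []; _∷_; zipWith; upTo)

ℕ→ℚ : ℕ → ℚ
ℕ→ℚ n = (+ n) / 1

_^ℚ_ : ℚ → ℕ → ℚ
p ^ℚ zero = 1ℚ
p ^ℚ suc n = p * (p ^ℚ n)

-- Σ_{i=a}^{b} f i  (empty, i.e. 0, when b < a)
sumFromTo : ℕ → ℕ → (ℕ → ℚ) → ℚ
sumFromTo a b f = go (suc b ℕ.∸ a)
  where
  go : ℕ → ℚ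
  go zero = 0ℚ
  go (suc r) = f (a ℕ.+ r) + go r

sumList : List ℚ → ℚ
sumList [] = 0ℚ
sumList (x ∷ xs) = x + sumList xs

rising : ℕ → ℕ → ℕ
rising a zero = 1
rising a (suc n) = rising a n ℕ.* (a ℕ.+ n)

rising≢0 : ∀ c n → .{{NonZero c}} → NonZero (rising c n)
rising≢0 c zero = _
rising≢0 (suc c) (suc n) = m*n≢0 (rising (suc c) n) (suc c ℕ.+ n) {{rising≢0 (suc c) n}}

Series : Set
Series = ℕ → ℚ

_⊛_ : Series → Series → Series
(f ⊛ g) n = sumFromTo 0 n (λ i → f i * g (n ℕ.∸ i))

oneS : Series
oneS zero = 1ℚ
oneS (suc _) = 0ℚ

_^S_ : Series → ℕ → Series
f ^S zero = oneS
f ^S suc k = f ⊛ (f ^S k)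

-- Coefficient of z^n in 2F1(a,b;c;z) = Σ (a)^(n)(b)^(n)/(c)^(n) z^n/n!
hyp2F1coeff : (a b c : ℕ) → .{{NonZero c}} → ℕ → ℚ
hyp2F1coeff a b c n =
  _/_ (+ (rising a n ℕ.* rising b n)) (rising c n ℕ.* n ℕ.!)
      {{m*n≢0 (rising c n) (n ℕ.!) {{rising≢0 c n}} {{n !≢0}}}}

-- the series x ↦ 2F1(a,b;c;-x)
hyp2F1neg : (a b c : ℕ) → .{{NonZero c}} → Series
hyp2F1neg a b c n = hyp2F1coeff a b c n * ((- 1ℚ) ^ℚ n)

-- Reciprocal 1/f of a power series f with constant term 1:
-- g 0 = 1, g n = - Σ_{j=1}^{n} f j * g (n - j)   (i.e. f ⊛ g = 1).
-- recipList f n = [g n, g (n-1), ..., g 0]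
recipList : Series → ℕ → List ℚ
recipList f zero = 1ℚ ∷ []
recipList f (suc n) =
  (- sumList (zipWith (λ j b → f (suc j) * b) (upTo (suc n)) (recipList f n)))
    ∷ recipList f n

headℚ : List ℚ → ℚ
headℚ [] = 0ℚ
headℚ (x ∷ _) = x

recip1 : Series → Series
recip1 f n = headℚ (recipList f n)

-- hypergeometric Cauchy numbers:
-- 1 / 2F1(1,N;N+1;-x) = Σ c_{N,n} x^n / n!
hypCauchy : ℕ → ℕ → ℚ
hypCauchy N n = ℕ→ℚ (n ℕ.!) * recip1 (hyp2F1neg 1 N (suc N)) n

-- -log(1-x) - F_{m-1}(x) = Σ_{j ≥ m} x^j / j   (for m ≥ 1)
logTail : ℕ → Series
logTail m zero = 0ℚ
logTail m (suc j) = if m ≤ᵇ suc j then (+ 1) / suc j else 0ℚ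

-- associated Stirling numbers of the first kind [n k]_{≥ m}:
-- (-log(1-x) - F_{m-1}(x))^k / k! = Σ [n k]_{≥m} x^n / n!
assocStirling1 : (m n k : ℕ) → ℚ
assocStirling1 m n k =
  ℕ→ℚ (n ℕ.!) * ((logTail m ^S k) n * _/_ (+ 1) (k ℕ.!) {{k !≢0}})

-- Put f(x) = ₂F₁(1,N;N+1;-x) = Σₙ (-1)ⁿ N/(N+n) xⁿ. As f(0) = 1, the geometric
-- series Σⱼ (1-f)ʲ inverts f, and (1-f)ʲ has no terms below xʲ, so [xⁿ] 1/f only
-- involves j ≤ n. Expanding (1-f)ʲ binomially and summing over j ≤ n by the
-- hockey-stick identity gives [xⁿ] 1/f = Σₖ (-1)ᵏ C(n+1,k+1) [xⁿ] fᵏ. Finally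
-- f(x) = N (-x)⁻ᴺ L(-x) for L(x) = -log(1-x) - F_{N-1}(x) = Σ_{j≥N} xʲ/j, so
-- [xⁿ] fᵏ = (-1)ⁿ Nᵏ [x^{n+Nk}] Lᵏ, and that coefficient of Lᵏ is the associated
-- Stirling number [n+Nk, k]_{≥N} scaled by k!/(n+Nk)!.
{-# OPTIONS --safe #-}
module Submission where

open import Defs
open import Data.Bool using (true; false)
open import Data.Empty using (⊥-elim)
open import Data.List using ([]; _∷_; applyUpTo; applyDownFrom; upTo; zipWith)
open import Data.Nat as ℕ using (ℕ; zero; suc; _≤_; _<_; s≤s; _!)
import Data.Nat.Properties as ℕP
open import Data.Nat.Properties using (_!≢0)
open import Data.Nat.Combinatorics using (_C_; nCk+nC[k+1]≡[n+1]C[k+1])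
open import Data.Integer as ℤ using ()
import Data.Integer.Properties as ℤP
open import Data.Rational as ℚ using (ℚ; 0ℚ; 1ℚ; _+_; _-_; _*_; -_; _/_; fromℚᵘ)
import Data.Rational.Properties as ℚP
open import Data.Rational.Unnormalised as ℚᵘ using (mkℚᵘ; *≡*)
import Data.Rational.Unnormalised.Properties as ℚᵘP
open import Data.Rational.Solver using (module +-*-Solver)
open +-*-Solver
open import Algebra.Properties.Group ℚP.+-0-group using (inverseˡ-unique)
open import Algebra.Properties.CommutativeSemigroup ℕP.+-commutativeSemigroup using (x∙yz≈y∙xz)
import Algebra.Properties.CommutativeSemigroup ℕP.*-commutativeSemigroup as ℕ*
open import Relation.Nullary using (yes; no)
open import Relation.Nullary.Reflects using (ofʸ; ofⁿ)
open import Relation.Binary.PropositionalEquality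
open ≡-Reasoning

fromℚᵘ-homo-+ : ∀ p q → fromℚᵘ (p ℚᵘ.+ q) ≡ fromℚᵘ p + fromℚᵘ q
fromℚᵘ-homo-+ p q = ℚP.toℚᵘ-injective (ℚᵘP.≃-trans (ℚP.toℚᵘ-fromℚᵘ _)
  (ℚᵘP.≃-trans (ℚᵘP.+-cong (ℚᵘP.≃-sym (ℚP.toℚᵘ-fromℚᵘ p)) (ℚᵘP.≃-sym (ℚP.toℚᵘ-fromℚᵘ q)))
    (ℚᵘP.≃-sym (ℚP.toℚᵘ-homo-+ (fromℚᵘ p) (fromℚᵘ q)))))

fromℚᵘ-homo-* : ∀ p q → fromℚᵘ (p ℚᵘ.* q) ≡ fromℚᵘ p * fromℚᵘ q
fromℚᵘ-homo-* p q = ℚP.toℚᵘ-injective (ℚᵘP.≃-trans (ℚP.toℚᵘ-fromℚᵘ _)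
  (ℚᵘP.≃-trans (ℚᵘP.*-cong (ℚᵘP.≃-sym (ℚP.toℚᵘ-fromℚᵘ p)) (ℚᵘP.≃-sym (ℚP.toℚᵘ-fromℚᵘ q)))
    (ℚᵘP.≃-sym (ℚP.toℚᵘ-homo-* (fromℚᵘ p) (fromℚᵘ q)))))

ℕ→ℚ-homo-+ : ∀ m n → ℕ→ℚ (m ℕ.+ n) ≡ ℕ→ℚ m + ℕ→ℚ n
ℕ→ℚ-homo-+ m n =
  trans (ℚP.fromℚᵘ-cong {mkℚᵘ (ℤ.+ (m ℕ.+ n)) 0} {mkℚᵘ (ℤ.+ m) 0 ℚᵘ.+ mkℚᵘ (ℤ.+ n) 0} (*≡* numerators))
        (fromℚᵘ-homo-+ (mkℚᵘ (ℤ.+ m) 0) (mkℚᵘ (ℤ.+ n) 0))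
  where
  open ℤP using (*-identityʳ)
  numerators : ℤ.+ (m ℕ.+ n) ℤ.* ℤ.1ℤ ≡ (ℤ.+ m ℤ.* ℤ.1ℤ ℤ.+ ℤ.+ n ℤ.* ℤ.1ℤ) ℤ.* ℤ.1ℤ
  numerators = begin
    ℤ.+ (m ℕ.+ n) ℤ.* ℤ.1ℤ                       ≡⟨ *-identityʳ _ ⟩
    ℤ.+ (m ℕ.+ n)                                ≡⟨ ℤP.pos-+ m n ⟩
    ℤ.+ m ℤ.+ ℤ.+ n                              ≡⟨ sym (cong₂ ℤ._+_ (*-identityʳ (ℤ.+ m)) (*-identityʳ (ℤ.+ n))) ⟩
    ℤ.+ m ℤ.* ℤ.1ℤ ℤ.+ ℤ.+ n ℤ.* ℤ.1ℤ              ≡⟨ sym (*-identityʳ _) ⟩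
    (ℤ.+ m ℤ.* ℤ.1ℤ ℤ.+ ℤ.+ n ℤ.* ℤ.1ℤ) ℤ.* ℤ.1ℤ   ∎

m/d≡m*[1/d] : ∀ m d .{{_ : ℕ.NonZero d}} → ℤ.+ m / d ≡ ℕ→ℚ m * (ℤ.1ℤ / d)
m/d≡m*[1/d] m (suc d) =
  trans (ℚP.fromℚᵘ-cong {mkℚᵘ (ℤ.+ m) d} {mkℚᵘ (ℤ.+ m) 0 ℚᵘ.* mkℚᵘ ℤ.1ℤ d}
                        (*≡* (sym (ℤP.*-assoc (ℤ.+ m) ℤ.1ℤ _))))
        (fromℚᵘ-homo-* (mkℚᵘ (ℤ.+ m) 0) (mkℚᵘ ℤ.1ℤ d))

[1/d]*d≡1 : ∀ d .{{_ : ℕ.NonZero d}} → (ℤ.1ℤ / d) * ℕ→ℚ d ≡ 1ℚ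
[1/d]*d≡1 (suc d) =
  trans (sym (fromℚᵘ-homo-* (mkℚᵘ ℤ.1ℤ d) (mkℚᵘ (ℤ.+ suc d) 0)))
        (ℚP.fromℚᵘ-cong {mkℚᵘ ℤ.1ℤ d ℚᵘ.* mkℚᵘ (ℤ.+ suc d) 0} {mkℚᵘ ℤ.1ℤ 0}
          (*≡* (trans (ℤP.*-identityʳ (ℤ.1ℤ ℤ.* ℤ.+ suc d))
                      (cong (ℤ.1ℤ ℤ.*_) (sym (ℤP.*-identityʳ (ℤ.+ suc d)))))))

m*d≡n*c⇒m/c≡n/d : ∀ m c n d .{{_ : ℕ.NonZero c}} .{{_ : ℕ.NonZero d}} →
                   m ℕ.* d ≡ n ℕ.* c → ℤ.+ m / c ≡ ℤ.+ n / d
m*d≡n*c⇒m/c≡n/d m (suc c) n (suc d) eq =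
  ℚP.fromℚᵘ-cong {mkℚᵘ (ℤ.+ m) c} {mkℚᵘ (ℤ.+ n) d}
    (*≡* (trans (sym (ℤP.pos-* m (suc d))) (trans (cong ℤ.+_ eq) (ℤP.pos-* n (suc c)))))

∑< : ℕ → (ℕ → ℚ) → ℚ
∑< zero    F = 0ℚ
∑< (suc r) F = F r + ∑< r F

syntax ∑< r (λ i → e) = ∑[ i < r ] e

sumFromTo0≡∑< : ∀ b F → sumFromTo 0 b F ≡ ∑< (suc b) F
sumFromTo0≡∑< zero    F = refl
sumFromTo0≡∑< (suc b) F = cong (F (suc b) +_) (sumFromTo0≡∑< b F)

sumFromTo1≡∑< : ∀ b F → sumFromTo 1 b F ≡ ∑[ i < b ] F (suc i)
sumFromTo1≡∑< zero    F = refl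
sumFromTo1≡∑< (suc b) F = cong (F (suc b) +_) (sumFromTo1≡∑< b F)

∑<-cong : ∀ r {F G} → (∀ i → i < r → F i ≡ G i) → ∑< r F ≡ ∑< r G
∑<-cong zero    eq = refl
∑<-cong (suc r) eq = cong₂ _+_ (eq r (ℕP.n<1+n r)) (∑<-cong r (λ i i<r → eq i (ℕP.m<n⇒m<1+n i<r)))

∑<-zeros : ∀ r {F} → (∀ i → i < r → F i ≡ 0ℚ) → ∑< r F ≡ 0ℚ
∑<-zeros zero    eq = refl
∑<-zeros (suc r) eq =
  trans (cong₂ _+_ (eq r (ℕP.n<1+n r)) (∑<-zeros r (λ i i<r → eq i (ℕP.m<n⇒m<1+n i<r))))
        (ℚP.+-identityˡ 0ℚ)

∑<-distrib-+ : ∀ r F G → ∑[ i < r ] (F i + G i) ≡ ∑< r F + ∑< r G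
∑<-distrib-+ zero    F G = refl
∑<-distrib-+ (suc r) F G = begin
  (F r + G r) + ∑[ i < r ] (F i + G i) ≡⟨ cong ((F r + G r) +_) (∑<-distrib-+ r F G) ⟩
  (F r + G r) + (∑< r F + ∑< r G)      ≡⟨ solve 4 (λ a b c d → (a :+ b) :+ (c :+ d) := (a :+ c) :+ (b :+ d))
                                                 refl (F r) (G r) (∑< r F) (∑< r G) ⟩
  (F r + ∑< r F) + (G r + ∑< r G)      ∎

∑<-distrib-- : ∀ r F G → ∑[ i < r ] (F i - G i) ≡ ∑< r F - ∑< r G
∑<-distrib-- zero    F G = refl
∑<-distrib-- (suc r) F G = begin
  (F r - G r) + ∑[ i < r ] (F i - G i) ≡⟨ cong ((F r - G r) +_) (∑<-distrib-- r F G) ⟩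
  (F r - G r) + (∑< r F - ∑< r G)      ≡⟨ solve 4 (λ a b c d → (a :- b) :+ (c :- d) := (a :+ c) :- (b :+ d))
                                                 refl (F r) (G r) (∑< r F) (∑< r G) ⟩
  (F r + ∑< r F) - (G r + ∑< r G)      ∎

∑<-distribˡ-* : ∀ r c F → ∑[ i < r ] (c * F i) ≡ c * ∑< r F
∑<-distribˡ-* zero    c F = sym (ℚP.*-zeroʳ c)
∑<-distribˡ-* (suc r) c F =
  trans (cong (c * F r +_) (∑<-distribˡ-* r c F)) (sym (ℚP.*-distribˡ-+ c (F r) (∑< r F)))

∑<-head : ∀ r F → ∑< (suc r) F ≡ F 0 + ∑[ i < r ] F (suc i)
∑<-head zero    F = refl
∑<-head (suc r) F = begin
  F (suc r) + ∑< (suc r) F                  ≡⟨ cong (F (suc r) +_) (∑<-head r F) ⟩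
  F (suc r) + (F 0 + ∑[ i < r ] F (suc i))  ≡⟨ solve 3 (λ a b c → a :+ (b :+ c) := b :+ (a :+ c))
                                                      refl (F (suc r)) (F 0) (∑[ i < r ] F (suc i)) ⟩
  F 0 + ∑[ i < suc r ] F (suc i)            ∎

∑<-split : ∀ r s F → ∑< (r ℕ.+ s) F ≡ ∑< r F + ∑[ i < s ] F (r ℕ.+ i)
∑<-split r zero    F = trans (cong (λ t → ∑< t F) (ℕP.+-identityʳ r)) (sym (ℚP.+-identityʳ _))
∑<-split r (suc s) F = begin
  ∑< (r ℕ.+ suc s) F                                    ≡⟨ cong (λ t → ∑< t F) (ℕP.+-suc r s) ⟩
  F (r ℕ.+ s) + ∑< (r ℕ.+ s) F                          ≡⟨ cong (F (r ℕ.+ s) +_) (∑<-split r s F) ⟩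
  F (r ℕ.+ s) + (∑< r F + ∑[ i < s ] F (r ℕ.+ i))       ≡⟨ solve 3 (λ a b c → a :+ (b :+ c) := b :+ (a :+ c))
                                                                  refl (F (r ℕ.+ s)) (∑< r F) _ ⟩
  ∑< r F + ∑[ i < suc s ] F (r ℕ.+ i)                   ∎

∑<-comm : ∀ r s (F : ℕ → ℕ → ℚ) → ∑[ i < r ] ∑[ j < s ] F i j ≡ ∑[ j < s ] ∑[ i < r ] F i j
∑<-comm zero    s F = sym (∑<-zeros s (λ _ _ → refl))
∑<-comm (suc r) s F = begin
  ∑[ j < s ] F r j + ∑[ i < r ] ∑[ j < s ] F i j   ≡⟨ cong (∑[ j < s ] F r j +_) (∑<-comm r s F) ⟩
  ∑[ j < s ] F r j + ∑[ j < s ] ∑[ i < r ] F i j   ≡⟨ sym (∑<-distrib-+ s (F r) (λ j → ∑[ i < r ] F i j)) ⟩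
  ∑[ j < s ] ∑[ i < suc r ] F i j                  ∎

∑<-truncate : ∀ m n F → m ≤ n → (∀ i → m ≤ i → i < n → F i ≡ 0ℚ) → ∑< n F ≡ ∑< m F
∑<-truncate m n F m≤n vanish = begin
  ∑< n F                                 ≡⟨ cong (λ t → ∑< t F) (sym (ℕP.m+[n∸m]≡n m≤n)) ⟩
  ∑< (m ℕ.+ (n ℕ.∸ m)) F                 ≡⟨ ∑<-split m (n ℕ.∸ m) F ⟩
  ∑< m F + ∑[ i < n ℕ.∸ m ] F (m ℕ.+ i)  ≡⟨ cong (∑< m F +_) (∑<-zeros (n ℕ.∸ m) tail-vanishes) ⟩
  ∑< m F + 0ℚ                            ≡⟨ ℚP.+-identityʳ _ ⟩
  ∑< m F                                 ∎
  where
  tail-vanishes : ∀ i → i < n ℕ.∸ m → F (m ℕ.+ i) ≡ 0ℚ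
  tail-vanishes i i<n∸m =
    vanish (m ℕ.+ i) (ℕP.m≤m+n m i) (subst (m ℕ.+ i <_) (ℕP.m+[n∸m]≡n m≤n) (ℕP.+-monoʳ-< m i<n∸m))

∑<-telescope : ∀ r (F : ℕ → ℚ) → ∑[ j < r ] (F j - F (suc j)) ≡ F 0 - F r
∑<-telescope zero    F = sym (ℚP.+-inverseʳ (F 0))
∑<-telescope (suc r) F = begin
  (F r - F (suc r)) + ∑[ j < r ] (F j - F (suc j)) ≡⟨ cong ((F r - F (suc r)) +_) (∑<-telescope r F) ⟩
  (F r - F (suc r)) + (F 0 - F r)                  ≡⟨ solve 3 (λ a b c → (a :- b) :+ (c :- a) := c :- b)
                                                              refl (F r) (F (suc r)) (F 0) ⟩
  F 0 - F (suc r)                                  ∎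

⊛-as-∑< : ∀ f g n → (f ⊛ g) n ≡ ∑[ i < suc n ] (f i * g (n ℕ.∸ i))
⊛-as-∑< f g n = sumFromTo0≡∑< n (λ i → f i * g (n ℕ.∸ i))

⊛-head : ∀ f g n → (f ⊛ g) n ≡ f 0 * g n + ∑[ i < n ] (f (suc i) * g (n ℕ.∸ suc i))
⊛-head f g n = trans (⊛-as-∑< f g n) (∑<-head n (λ i → f i * g (n ℕ.∸ i)))

⊛-∑<-distribˡ : ∀ f g R (c : ℕ → ℚ) (Q : ℕ → Series) m →
                (∀ t → t ≤ m → g t ≡ ∑[ k < R ] (c k * Q k t)) →
                (f ⊛ g) m ≡ ∑[ k < R ] (c k * (f ⊛ Q k) m)
⊛-∑<-distribˡ f g R c Q m g≡∑ = begin
  (f ⊛ g) m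
    ≡⟨ ⊛-as-∑< f g m ⟩
  ∑[ i < suc m ] (f i * g (m ℕ.∸ i))
    ≡⟨ ∑<-cong (suc m) expand ⟩
  ∑[ i < suc m ] ∑[ k < R ] (c k * (f i * Q k (m ℕ.∸ i)))
    ≡⟨ ∑<-comm (suc m) R _ ⟩
  ∑[ k < R ] ∑[ i < suc m ] (c k * (f i * Q k (m ℕ.∸ i)))
    ≡⟨ ∑<-cong R (λ k _ → trans (∑<-distribˡ-* (suc m) (c k) _) (cong (c k *_) (sym (⊛-as-∑< f (Q k) m)))) ⟩
  ∑[ k < R ] (c k * (f ⊛ Q k) m) ∎
  where
  expand : ∀ i → i < suc m → f i * g (m ℕ.∸ i) ≡ ∑[ k < R ] (c k * (f i * Q k (m ℕ.∸ i)))
  expand i _ = begin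
    f i * g (m ℕ.∸ i)                         ≡⟨ cong (f i *_) (g≡∑ (m ℕ.∸ i) (ℕP.m∸n≤m m i)) ⟩
    f i * ∑[ k < R ] (c k * Q k (m ℕ.∸ i))    ≡⟨ sym (∑<-distribˡ-* R (f i) _) ⟩
    ∑[ k < R ] (f i * (c k * Q k (m ℕ.∸ i)))  ≡⟨ ∑<-cong R (λ k _ → solve 3 (λ x y z → x :* (y :* z) := y :* (x :* z))
                                                                   refl (f i) (c k) (Q k (m ℕ.∸ i))) ⟩
    ∑[ k < R ] (c k * (f i * Q k (m ℕ.∸ i)))  ∎

sumList-zipWith≡∑< : ∀ (F g : ℕ → ℚ) n (σ : ℕ → ℕ) →
  sumList (zipWith (λ j b → F j * b) (applyUpTo σ (suc n)) (applyDownFrom g (suc n)))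
    ≡ ∑[ i < suc n ] (F (σ i) * g (n ℕ.∸ i))
sumList-zipWith≡∑< F g zero    σ = refl
sumList-zipWith≡∑< F g (suc n) σ =
  trans (cong (F (σ 0) * g (suc n) +_) (sumList-zipWith≡∑< F g n (λ i → σ (suc i))))
        (sym (∑<-head (suc n) (λ i → F (σ i) * g (suc n ℕ.∸ i))))

recipList≡applyDownFrom : ∀ f g → f 0 ≡ 1ℚ → (∀ n → (f ⊛ g) n ≡ oneS n) →
                          ∀ n → recipList f n ≡ applyDownFrom g (suc n)
recipList≡applyDownFrom f g f0≡1 fg≡1 zero = cong (_∷ []) (begin
  1ℚ                ≡⟨ sym (fg≡1 0) ⟩
  f 0 * g 0 + 0ℚ    ≡⟨ cong (λ x → x * g 0 + 0ℚ) f0≡1 ⟩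
  1ℚ * g 0 + 0ℚ     ≡⟨ solve 1 (λ x → con 1ℚ :* x :+ con 0ℚ := x) refl (g 0) ⟩
  g 0               ∎)
recipList≡applyDownFrom f g f0≡1 fg≡1 (suc n)
  rewrite recipList≡applyDownFrom f g f0≡1 fg≡1 n = cong (_∷ applyDownFrom g (suc n)) (begin
    - sumList (zipWith (λ j b → f (suc j) * b) (upTo (suc n)) (applyDownFrom g (suc n)))
      ≡⟨ cong -_ (sumList-zipWith≡∑< (λ j → f (suc j)) g n (λ i → i)) ⟩
    - S ≡⟨ sym (inverseˡ-unique (g (suc n)) S g+S≡0) ⟩
    g (suc n) ∎)
  where
  S : ℚ
  S = ∑[ i < suc n ] (f (suc i) * g (n ℕ.∸ i))

  g+S≡0 : g (suc n) + S ≡ 0ℚ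
  g+S≡0 = begin
    g (suc n) + S       ≡⟨ cong (_+ S) (sym (trans (cong (_* g (suc n)) f0≡1) (ℚP.*-identityˡ (g (suc n))))) ⟩
    f 0 * g (suc n) + S ≡⟨ sym (⊛-head f g (suc n)) ⟩
    (f ⊛ g) (suc n)     ≡⟨ fg≡1 (suc n) ⟩
    0ℚ                  ∎

recip1-unique : ∀ f g → f 0 ≡ 1ℚ → (∀ n → (f ⊛ g) n ≡ oneS n) → ∀ n → recip1 f n ≡ g n
recip1-unique f g f0≡1 fg≡1 n = cong headℚ (recipList≡applyDownFrom f g f0≡1 fg≡1 n)

sgn : ℕ → ℚ
sgn k = (- 1ℚ) ^ℚ k

signedC : ℕ → ℕ → ℚ
signedC j k = sgn k * ℕ→ℚ (j C k)

signedC-pascal : ∀ j k → signedC (suc j) (suc k) ≡ signedC j (suc k) - signedC j k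
signedC-pascal j k = begin
  (- 1ℚ * sgn k) * ℕ→ℚ (suc j C suc k)
    ≡⟨ cong (λ c → (- 1ℚ * sgn k) * ℕ→ℚ c) (sym (nCk+nC[k+1]≡[n+1]C[k+1] j k)) ⟩
  (- 1ℚ * sgn k) * ℕ→ℚ (j C k ℕ.+ j C suc k)
    ≡⟨ cong ((- 1ℚ * sgn k) *_) (ℕ→ℚ-homo-+ (j C k) (j C suc k)) ⟩
  (- 1ℚ * sgn k) * (ℕ→ℚ (j C k) + ℕ→ℚ (j C suc k))
    ≡⟨ solve 3 (λ s a b → (:- con 1ℚ :* s) :* (a :+ b) := (:- con 1ℚ :* s) :* b :- s :* a)
               refl (sgn k) (ℕ→ℚ (j C k)) (ℕ→ℚ (j C suc k)) ⟩
  signedC j (suc k) - signedC j k ∎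

hockey-stick : ∀ n k → ∑[ j < suc n ] ℕ→ℚ (j C k) ≡ ℕ→ℚ (suc n C suc k)
hockey-stick zero    zero    = refl
hockey-stick zero    (suc k) = refl
hockey-stick (suc n) k = begin
  ℕ→ℚ (suc n C k) + ∑[ j < suc n ] ℕ→ℚ (j C k) ≡⟨ cong (ℕ→ℚ (suc n C k) +_) (hockey-stick n k) ⟩
  ℕ→ℚ (suc n C k) + ℕ→ℚ (suc n C suc k)        ≡⟨ sym (ℕ→ℚ-homo-+ (suc n C k) (suc n C suc k)) ⟩
  ℕ→ℚ (suc n C k ℕ.+ suc n C suc k)            ≡⟨ cong ℕ→ℚ (nCk+nC[k+1]≡[n+1]C[k+1] (suc n) k) ⟩
  ℕ→ℚ (suc (suc n) C suc k)                    ∎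

module _ (f : Series) where

  [1-f]^ : ℕ → Series
  [1-f]^ zero      = oneS
  [1-f]^ (suc j) m = [1-f]^ j m - (f ⊛ [1-f]^ j) m

  [1-f]^-vanish : f 0 ≡ 1ℚ → ∀ j m → m < j → [1-f]^ j m ≡ 0ℚ
  [1-f]^-vanish f0≡1 (suc j) m (s≤s m≤j) = begin
    u m - (f ⊛ u) m                                                 ≡⟨ cong (λ x → u m - x) (⊛-head f u m) ⟩
    u m - (f 0 * u m + ∑[ i < m ] (f (suc i) * u (m ℕ.∸ suc i)))     ≡⟨ cong₂ (λ c S → u m - (c * u m + S))
                                                                              f0≡1 (∑<-zeros m lower-terms) ⟩
    u m - (1ℚ * u m + 0ℚ)                                           ≡⟨ solve 1 (λ x → x :- (con 1ℚ :* x :+ con 0ℚ) := con 0ℚ)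
                                                                              refl (u m) ⟩
    0ℚ                                                              ∎
    where
    u : Series
    u = [1-f]^ j

    lower-terms : ∀ i → i < m → f (suc i) * u (m ℕ.∸ suc i) ≡ 0ℚ
    lower-terms i i<m = trans (cong (f (suc i) *_) ([1-f]^-vanish f0≡1 j (m ℕ.∸ suc i) m∸[1+i]<j))
                              (ℚP.*-zeroʳ (f (suc i)))
      where
      m∸[1+i]<j : m ℕ.∸ suc i < j
      m∸[1+i]<j = ℕP.<-≤-trans (ℕP.∸-monoʳ-< ℕ.z<s i<m) m≤j

  [1-f]^-binomial : ∀ j R → j < R → ∀ m → [1-f]^ j m ≡ ∑[ k < R ] (signedC j k * (f ^S k) m)
  [1-f]^-binomial zero (suc R) _ m = sym (begin
    ∑[ k < suc R ] (signedC 0 k * (f ^S k) m)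
      ≡⟨ ∑<-head R (λ k → signedC 0 k * (f ^S k) m) ⟩
    signedC 0 0 * oneS m + ∑[ k < R ] (signedC 0 (suc k) * (f ^S suc k) m)
      ≡⟨ cong (signedC 0 0 * oneS m +_) (∑<-zeros R (λ k _ →
           solve 2 (λ s p → s :* con 0ℚ :* p := con 0ℚ) refl (sgn (suc k)) ((f ^S suc k) m))) ⟩
    (1ℚ * 1ℚ) * oneS m + 0ℚ
      ≡⟨ solve 1 (λ x → (con 1ℚ :* con 1ℚ) :* x :+ con 0ℚ := x) refl (oneS m) ⟩
    oneS m ∎)
  [1-f]^-binomial (suc j) (suc R) (s≤s j<R) m = sym (begin
    ∑[ k < suc R ] (signedC (suc j) k * P k)
      ≡⟨ ∑<-head R (λ k → signedC (suc j) k * P k) ⟩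
    signedC j 0 * P 0 + ∑[ k < R ] (signedC (suc j) (suc k) * P (suc k))
      ≡⟨ cong (signedC j 0 * P 0 +_) (trans (∑<-cong R (λ k _ → pascal-term k))
                                            (∑<-distrib-- R (λ k → signedC j (suc k) * P (suc k)) _)) ⟩
    signedC j 0 * P 0 + (∑[ k < R ] (signedC j (suc k) * P (suc k)) - ∑[ k < R ] (signedC j k * P (suc k)))
      ≡⟨ solve 3 (λ a b c → a :+ (b :- c) := (a :+ b) :- c) refl (signedC j 0 * P 0) _ _ ⟩
    (signedC j 0 * P 0 + ∑[ k < R ] (signedC j (suc k) * P (suc k))) - ∑[ k < R ] (signedC j k * P (suc k))
      ≡⟨ cong₂ _-_ (sym (∑<-head R (λ k → signedC j k * P k)))
                   (sym (⊛-∑<-distribˡ f ([1-f]^ j) R (signedC j) (f ^S_) m (λ t _ → [1-f]^-binomial j R j<R t))) ⟩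
    ∑[ k < suc R ] (signedC j k * P k) - (f ⊛ [1-f]^ j) m
      ≡⟨ cong (_- (f ⊛ [1-f]^ j) m) (sym ([1-f]^-binomial j (suc R) (ℕP.m<n⇒m<1+n j<R) m)) ⟩
    [1-f]^ j m - (f ⊛ [1-f]^ j) m ∎)
    where
    P : ℕ → ℚ
    P k = (f ^S k) m

    pascal-term : ∀ k → signedC (suc j) (suc k) * P (suc k)
                          ≡ signedC j (suc k) * P (suc k) - signedC j k * P (suc k)
    pascal-term k = trans (cong (_* P (suc k)) (signedC-pascal j k))
                          (solve 3 (λ a b x → (a :- b) :* x := a :* x :- b :* x)
                                   refl (signedC j (suc k)) (signedC j k) (P (suc k)))

  f⁻¹ : Series
  f⁻¹ m = ∑[ j < suc m ] [1-f]^ j m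

  module _ (f0≡1 : f 0 ≡ 1ℚ) where

    f⁻¹-extend : ∀ {m n} → m ≤ n → f⁻¹ m ≡ ∑[ j < suc n ] (1ℚ * [1-f]^ j m)
    f⁻¹-extend {m} {n} m≤n = begin
      ∑[ j < suc m ] [1-f]^ j m         ≡⟨ sym (∑<-truncate (suc m) (suc n) _ (s≤s m≤n)
                                                           (λ j m<j _ → [1-f]^-vanish f0≡1 j m m<j)) ⟩
      ∑[ j < suc n ] [1-f]^ j m         ≡⟨ ∑<-cong (suc n) (λ j _ → sym (ℚP.*-identityˡ ([1-f]^ j m))) ⟩
      ∑[ j < suc n ] (1ℚ * [1-f]^ j m)  ∎

    ⊛-f⁻¹ : ∀ n → (f ⊛ f⁻¹) n ≡ oneS n
    ⊛-f⁻¹ n = begin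
      (f ⊛ f⁻¹) n                                     ≡⟨ ⊛-∑<-distribˡ f f⁻¹ (suc n) (λ _ → 1ℚ) [1-f]^ n (λ _ → f⁻¹-extend) ⟩
      ∑[ j < suc n ] (1ℚ * (f ⊛ [1-f]^ j) n)          ≡⟨ ∑<-cong (suc n) (λ j _ → telescoping-term j) ⟩
      ∑[ j < suc n ] ([1-f]^ j n - [1-f]^ (suc j) n)  ≡⟨ ∑<-telescope (suc n) (λ j → [1-f]^ j n) ⟩
      oneS n - [1-f]^ (suc n) n                       ≡⟨ cong (λ x → oneS n - x) ([1-f]^-vanish f0≡1 (suc n) n (ℕP.n<1+n n)) ⟩
      oneS n - 0ℚ                                     ≡⟨ solve 1 (λ x → x :- con 0ℚ := x) refl (oneS n) ⟩
      oneS n                                          ∎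
      where
      telescoping-term : ∀ j → 1ℚ * (f ⊛ [1-f]^ j) n ≡ [1-f]^ j n - [1-f]^ (suc j) n
      telescoping-term j = solve 2 (λ p x → con 1ℚ :* p := x :- (x :- p)) refl ((f ⊛ [1-f]^ j) n) ([1-f]^ j n)

    recip1-binomial : ∀ n → recip1 f n ≡ ∑[ k < suc n ] ((sgn k * (f ^S k) n) * ℕ→ℚ (suc n C suc k))
    recip1-binomial n = begin
      recip1 f n                                            ≡⟨ recip1-unique f f⁻¹ f0≡1 ⊛-f⁻¹ n ⟩
      ∑[ j < suc n ] [1-f]^ j n                             ≡⟨ ∑<-cong (suc n) (λ j j≤n → [1-f]^-binomial j (suc n) j≤n n) ⟩
      ∑[ j < suc n ] ∑[ k < suc n ] (signedC j k * P k)     ≡⟨ ∑<-comm (suc n) (suc n) (λ j k → signedC j k * P k) ⟩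
      ∑[ k < suc n ] ∑[ j < suc n ] (signedC j k * P k)     ≡⟨ ∑<-cong (suc n) (λ k _ → sum-over-j k) ⟩
      ∑[ k < suc n ] ((sgn k * P k) * ℕ→ℚ (suc n C suc k))  ∎
      where
      P : ℕ → ℚ
      P k = (f ^S k) n

      sum-over-j : ∀ k → ∑[ j < suc n ] (signedC j k * P k) ≡ (sgn k * P k) * ℕ→ℚ (suc n C suc k)
      sum-over-j k = begin
        ∑[ j < suc n ] (signedC j k * P k)            ≡⟨ ∑<-cong (suc n) (λ j _ → solve 3 (λ s c p → s :* c :* p := (s :* p) :* c)
                                                                                      refl (sgn k) (ℕ→ℚ (j C k)) (P k)) ⟩
        ∑[ j < suc n ] ((sgn k * P k) * ℕ→ℚ (j C k))  ≡⟨ ∑<-distribˡ-* (suc n) (sgn k * P k) _ ⟩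
        (sgn k * P k) * ∑[ j < suc n ] ℕ→ℚ (j C k)    ≡⟨ cong ((sgn k * P k) *_) (hockey-stick n k) ⟩
        (sgn k * P k) * ℕ→ℚ (suc n C suc k)           ∎

^ℚ-distribˡ-+-* : ∀ x m n → x ^ℚ (m ℕ.+ n) ≡ x ^ℚ m * x ^ℚ n
^ℚ-distribˡ-+-* x zero    n = sym (ℚP.*-identityˡ (x ^ℚ n))
^ℚ-distribˡ-+-* x (suc m) n =
  trans (cong (x *_) (^ℚ-distribˡ-+-* x m n)) (sym (ℚP.*-assoc x (x ^ℚ m) (x ^ℚ n)))

^ℚ-distribʳ-* : ∀ x y n → (x * y) ^ℚ n ≡ x ^ℚ n * y ^ℚ n
^ℚ-distribʳ-* x y zero    = refl
^ℚ-distribʳ-* x y (suc n) =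
  trans (cong ((x * y) *_) (^ℚ-distribʳ-* x y n))
        (solve 4 (λ x y p q → (x :* y) :* (p :* q) := (x :* p) :* (y :* q)) refl x y (x ^ℚ n) (y ^ℚ n))

^S-twist : ∀ (s c : ℚ) (f b : Series) → (∀ n → f n ≡ s ^ℚ n * (c * b n)) →
           ∀ k n → (f ^S k) n ≡ s ^ℚ n * (c ^ℚ k * (b ^S k) n)
^S-twist s c f b f≡ zero    zero    = refl
^S-twist s c f b f≡ zero    (suc n) = solve 1 (λ p → con 0ℚ := p :* (con 1ℚ :* con 0ℚ)) refl (s ^ℚ suc n)
^S-twist s c f b f≡ (suc k) n = begin
  (f ⊛ (f ^S k)) n                                      ≡⟨ ⊛-as-∑< f (f ^S k) n ⟩
  ∑[ i < suc n ] (f i * (f ^S k) (n ℕ.∸ i))             ≡⟨ ∑<-cong (suc n) (λ i i≤n → term i (ℕP.≤-pred i≤n)) ⟩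
  ∑[ i < suc n ] (scale * (b i * (b ^S k) (n ℕ.∸ i)))     ≡⟨ ∑<-distribˡ-* (suc n) scale _ ⟩
  scale * ∑[ i < suc n ] (b i * (b ^S k) (n ℕ.∸ i))       ≡⟨ cong (scale *_) (sym (⊛-as-∑< b (b ^S k) n)) ⟩
  scale * (b ⊛ (b ^S k)) n                                ≡⟨ ℚP.*-assoc (s ^ℚ n) (c * c ^ℚ k) _ ⟩
  s ^ℚ n * ((c * c ^ℚ k) * (b ⊛ (b ^S k)) n)            ∎
  where
  scale : ℚ
  scale = s ^ℚ n * (c * c ^ℚ k)

  term : ∀ i → i ≤ n → f i * (f ^S k) (n ℕ.∸ i) ≡ scale * (b i * (b ^S k) (n ℕ.∸ i))
  term i i≤n = begin
    f i * (f ^S k) (n ℕ.∸ i)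
      ≡⟨ cong₂ _*_ (f≡ i) (^S-twist s c f b f≡ k (n ℕ.∸ i)) ⟩
    (s ^ℚ i * (c * b i)) * (s ^ℚ (n ℕ.∸ i) * (c ^ℚ k * (b ^S k) (n ℕ.∸ i)))
      ≡⟨ solve 6 (λ p q x y z w → (p :* (x :* y)) :* (q :* (z :* w)) := ((p :* q) :* (x :* z)) :* (y :* w))
                 refl (s ^ℚ i) (s ^ℚ (n ℕ.∸ i)) c (b i) (c ^ℚ k) ((b ^S k) (n ℕ.∸ i)) ⟩
    (s ^ℚ i * s ^ℚ (n ℕ.∸ i)) * (c * c ^ℚ k) * (b i * (b ^S k) (n ℕ.∸ i))
      ≡⟨ cong (λ p → p * (c * c ^ℚ k) * (b i * (b ^S k) (n ℕ.∸ i)))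
              (trans (sym (^ℚ-distribˡ-+-* s i (n ℕ.∸ i))) (cong (s ^ℚ_) (ℕP.m+[n∸m]≡n i≤n))) ⟩
    scale * (b i * (b ^S k) (n ℕ.∸ i)) ∎

module _ (N : ℕ) (a : Series) (a-vanish : ∀ j → j < N → a j ≡ 0ℚ) where

  ⊛-shiftˡ : ∀ g m → (a ⊛ g) (N ℕ.+ m) ≡ ∑[ t < suc m ] (a (N ℕ.+ t) * g (m ℕ.∸ t))
  ⊛-shiftˡ g m = begin
    (a ⊛ g) (N ℕ.+ m)                                ≡⟨ ⊛-as-∑< a g (N ℕ.+ m) ⟩
    ∑< (suc (N ℕ.+ m)) G                             ≡⟨ cong (λ r → ∑< r G) (sym (ℕP.+-suc N m)) ⟩
    ∑< (N ℕ.+ suc m) G                               ≡⟨ ∑<-split N (suc m) G ⟩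
    ∑< N G + ∑[ t < suc m ] G (N ℕ.+ t)              ≡⟨ cong₂ _+_ (∑<-zeros N low) (∑<-cong (suc m) high) ⟩
    0ℚ + ∑[ t < suc m ] (a (N ℕ.+ t) * g (m ℕ.∸ t))  ≡⟨ ℚP.+-identityˡ _ ⟩
    ∑[ t < suc m ] (a (N ℕ.+ t) * g (m ℕ.∸ t))       ∎
    where
    G : ℕ → ℚ
    G i = a i * g (N ℕ.+ m ℕ.∸ i)

    low : ∀ i → i < N → G i ≡ 0ℚ
    low i i<N = trans (cong (_* g (N ℕ.+ m ℕ.∸ i)) (a-vanish i i<N)) (ℚP.*-zeroˡ (g (N ℕ.+ m ℕ.∸ i)))

    high : ∀ t → t < suc m → G (N ℕ.+ t) ≡ a (N ℕ.+ t) * g (m ℕ.∸ t)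
    high t _ = cong (λ i → a (N ℕ.+ t) * g i) (ℕP.[m+n]∸[m+o]≡n∸o N m t)

  ^S-vanish : ∀ k m → m < N ℕ.* k → (a ^S k) m ≡ 0ℚ
  ^S-vanish zero    m m<0 = ⊥-elim (ℕP.n≮0 (subst (m <_) (ℕP.*-zeroʳ N) m<0))
  ^S-vanish (suc k) m m<N+Nk = trans (⊛-as-∑< a (a ^S k) m) (∑<-zeros (suc m) term)
    where
    term : ∀ i → i < suc m → a i * (a ^S k) (m ℕ.∸ i) ≡ 0ℚ
    term i i≤m with i ℕP.<? N
    ... | yes i<N =
      trans (cong (_* (a ^S k) (m ℕ.∸ i)) (a-vanish i i<N)) (ℚP.*-zeroˡ ((a ^S k) (m ℕ.∸ i)))
    ... | no  i≮N = trans (cong (a i *_) (^S-vanish k (m ℕ.∸ i) m∸i<Nk)) (ℚP.*-zeroʳ (a i))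
      where
      m<i+Nk : m < i ℕ.+ N ℕ.* k
      m<i+Nk = ℕP.<-≤-trans (subst (m <_) (ℕP.*-suc N k) m<N+Nk)
                            (ℕP.+-monoˡ-≤ (N ℕ.* k) (ℕP.≮⇒≥ i≮N))

      m∸i<Nk : m ℕ.∸ i < N ℕ.* k
      m∸i<Nk = subst (m ℕ.∸ i <_) (ℕP.m+n∸m≡n i (N ℕ.* k)) (ℕP.∸-monoˡ-< m<i+Nk (ℕP.≤-pred i≤m))

  ^S-shift : ∀ k n → (a ^S k) (n ℕ.+ N ℕ.* k) ≡ ((λ t → a (N ℕ.+ t)) ^S k) n
  ^S-shift zero    n = cong oneS (trans (cong (n ℕ.+_) (ℕP.*-zeroʳ N)) (ℕP.+-identityʳ n))
  ^S-shift (suc k) n = begin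
    (a ⊛ (a ^S k)) (n ℕ.+ N ℕ.* suc k)                  ≡⟨ cong (a ⊛ (a ^S k)) index ⟩
    (a ⊛ (a ^S k)) (N ℕ.+ (n ℕ.+ Nk))                   ≡⟨ ⊛-shiftˡ (a ^S k) (n ℕ.+ Nk) ⟩
    ∑[ t < suc (n ℕ.+ Nk) ] (b t * (a ^S k) (n+Nk∸ t))  ≡⟨ ∑<-truncate (suc n) (suc (n ℕ.+ Nk)) _
                                                                        (s≤s (ℕP.m≤m+n n Nk)) beyond-n ⟩
    ∑[ t < suc n ] (b t * (a ^S k) (n+Nk∸ t))           ≡⟨ ∑<-cong (suc n) (λ t t≤n → cong (b t *_) (shifted t (ℕP.≤-pred t≤n))) ⟩
    ∑[ t < suc n ] (b t * (b ^S k) (n ℕ.∸ t))           ≡⟨ sym (⊛-as-∑< b (b ^S k) n) ⟩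
    (b ⊛ (b ^S k)) n                                    ∎
    where
    b : Series
    b t = a (N ℕ.+ t)

    Nk : ℕ
    Nk = N ℕ.* k

    n+Nk∸ : ℕ → ℕ
    n+Nk∸ t = n ℕ.+ Nk ℕ.∸ t

    index : n ℕ.+ N ℕ.* suc k ≡ N ℕ.+ (n ℕ.+ Nk)
    index = trans (cong (n ℕ.+_) (ℕP.*-suc N k)) (x∙yz≈y∙xz n N Nk)

    beyond-n : ∀ t → suc n ≤ t → t < suc (n ℕ.+ Nk) → b t * (a ^S k) (n+Nk∸ t) ≡ 0ℚ
    beyond-n t n<t t≤n+Nk = trans (cong (b t *_) (^S-vanish k (n+Nk∸ t) n+Nk∸t<Nk)) (ℚP.*-zeroʳ (b t))
      where
      n+Nk∸t<Nk : n+Nk∸ t < Nk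
      n+Nk∸t<Nk = subst (n+Nk∸ t <_) (ℕP.m+n∸m≡n n Nk) (ℕP.∸-monoʳ-< n<t (ℕP.≤-pred t≤n+Nk))

    shifted : ∀ t → t ≤ n → (a ^S k) (n+Nk∸ t) ≡ (b ^S k) (n ℕ.∸ t)
    shifted t t≤n = trans (cong (a ^S k) (ℕP.+-∸-comm Nk t≤n)) (^S-shift k (n ℕ.∸ t))

rising-1 : ∀ n → rising 1 n ≡ n !
rising-1 zero    = refl
rising-1 (suc n) = trans (cong (ℕ._* suc n) (rising-1 n)) (ℕP.*-comm (n !) (suc n))

rising-*-+ : ∀ N n → rising N n ℕ.* (N ℕ.+ n) ≡ N ℕ.* rising (suc N) n
rising-*-+ N zero    = trans (ℕP.*-identityˡ (N ℕ.+ 0)) (trans (ℕP.+-identityʳ N) (sym (ℕP.*-identityʳ N)))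
rising-*-+ N (suc n) =
  trans (cong₂ ℕ._*_ (rising-*-+ N n) (ℕP.+-suc N n)) (ℕP.*-assoc N (rising (suc N) n) (suc (N ℕ.+ n)))

hyp2F1coeff-1-N-[N+1] : ∀ N n → hyp2F1coeff 1 (suc N) (suc (suc N)) n ≡ ℕ→ℚ (suc N) * (ℤ.1ℤ / (suc N ℕ.+ n))
hyp2F1coeff-1-N-[N+1] N n =
  trans (m*d≡n*c⇒m/c≡n/d (r₁ ℕ.* rN) (rN+1 ℕ.* n !) (suc N) (suc N ℕ.+ n) {{denominator≢0}} cross-multiplied)
        (m/d≡m*[1/d] (suc N) (suc N ℕ.+ n))
  where
  r₁ rN rN+1 : ℕ
  r₁ = rising 1 n
  rN = rising (suc N) n
  rN+1 = rising (suc (suc N)) n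

  denominator≢0 : ℕ.NonZero (rN+1 ℕ.* n !)
  denominator≢0 = ℕP.m*n≢0 rN+1 (n !) {{rising≢0 (suc (suc N)) n}} {{n !≢0}}

  cross-multiplied : (r₁ ℕ.* rN) ℕ.* (suc N ℕ.+ n) ≡ suc N ℕ.* (rN+1 ℕ.* n !)
  cross-multiplied = begin
    (r₁ ℕ.* rN) ℕ.* (suc N ℕ.+ n)    ≡⟨ cong (λ r → (r ℕ.* rN) ℕ.* (suc N ℕ.+ n)) (rising-1 n) ⟩
    (n ! ℕ.* rN) ℕ.* (suc N ℕ.+ n)   ≡⟨ ℕP.*-assoc (n !) rN (suc N ℕ.+ n) ⟩
    n ! ℕ.* (rN ℕ.* (suc N ℕ.+ n))   ≡⟨ cong (n ! ℕ.*_) (rising-*-+ (suc N) n) ⟩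
    n ! ℕ.* (suc N ℕ.* rN+1)         ≡⟨ ℕ*.x∙yz≈y∙zx (n !) (suc N) rN+1 ⟩
    suc N ℕ.* (rN+1 ℕ.* n !)         ∎

logTail-< : ∀ m j → j < m → logTail m j ≡ 0ℚ
logTail-< m zero    _   = refl
logTail-< m (suc j) j<m with m ℕ.≤ᵇ suc j | ℕP.≤ᵇ-reflects-≤ m (suc j)
... | true  | ofʸ m≤j = ⊥-elim (ℕP.<⇒≱ j<m m≤j)
... | false | _       = refl

logTail-≥ : ∀ m j → m ≤ suc j → logTail m (suc j) ≡ ℤ.1ℤ / suc j
logTail-≥ m j m≤j with m ℕ.≤ᵇ suc j | ℕP.≤ᵇ-reflects-≤ m (suc j)
... | true  | _       = refl
... | false | ofⁿ m≰j = ⊥-elim (m≰j m≤j)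

assocStirling1-as-coefficient : ∀ N m k →
  _/_ (ℤ.+ (k !)) (m !) {{m !≢0}} * assocStirling1 N m k ≡ (logTail N ^S k) m
assocStirling1-as-coefficient N m k = begin
  ℤ.+ (k !) / (m !) * (ℕ→ℚ (m !) * (X * 1/k!))
    ≡⟨ cong (_* (ℕ→ℚ (m !) * (X * 1/k!))) (m/d≡m*[1/d] (k !) (m !)) ⟩
  (ℕ→ℚ (k !) * 1/m!) * (ℕ→ℚ (m !) * (X * 1/k!))
    ≡⟨ solve 5 (λ K im M X ik → (K :* im) :* (M :* (X :* ik)) := (im :* M) :* ((ik :* K) :* X))
               refl (ℕ→ℚ (k !)) 1/m! (ℕ→ℚ (m !)) X 1/k! ⟩
  (1/m! * ℕ→ℚ (m !)) * ((1/k! * ℕ→ℚ (k !)) * X)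
    ≡⟨ cong₂ (λ u v → u * (v * X)) ([1/d]*d≡1 (m !)) ([1/d]*d≡1 (k !)) ⟩
  1ℚ * (1ℚ * X)
    ≡⟨ solve 1 (λ X → con 1ℚ :* (con 1ℚ :* X) := X) refl X ⟩
  X ∎
  where
  instance
    m!≢0 : ℕ.NonZero (m !)
    m!≢0 = m !≢0
    k!≢0 : ℕ.NonZero (k !)
    k!≢0 = k !≢0
  X 1/m! 1/k! : ℚ
  X = (logTail N ^S k) m
  1/m! = ℤ.1ℤ / (m !)
  1/k! = ℤ.1ℤ / (k !)

hyp2F1neg-1-N-[N+1] : ∀ N n → hyp2F1neg 1 (suc N) (suc (suc N)) n
                               ≡ (- 1ℚ) ^ℚ n * (ℕ→ℚ (suc N) * logTail (suc N) (suc N ℕ.+ n))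
hyp2F1neg-1-N-[N+1] N n = begin
  hyp2F1coeff 1 (suc N) (suc (suc N)) n * sgn n         ≡⟨ cong (_* sgn n) (hyp2F1coeff-1-N-[N+1] N n) ⟩
  (ℕ→ℚ (suc N) * (ℤ.1ℤ / (suc N ℕ.+ n))) * sgn n        ≡⟨ ℚP.*-comm _ (sgn n) ⟩
  sgn n * (ℕ→ℚ (suc N) * (ℤ.1ℤ / (suc N ℕ.+ n)))        ≡⟨ cong (λ x → sgn n * (ℕ→ℚ (suc N) * x)) (sym logTail-N+n) ⟩
  sgn n * (ℕ→ℚ (suc N) * logTail (suc N) (suc N ℕ.+ n)) ∎
  where
  logTail-N+n : logTail (suc N) (suc N ℕ.+ n) ≡ ℤ.1ℤ / (suc N ℕ.+ n)
  logTail-N+n = logTail-≥ (suc N) (N ℕ.+ n) (s≤s (ℕP.m≤m+n N n))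

-- Opened only now: with +_ in scope, the sections (x +_) used above would not parse.
open import Data.Integer using (+_)

cauchyTerm : ℕ → ℕ → ℕ → ℚ
cauchyTerm N n k =
  ℕ→ℚ ((n ℕ.+ 1) C (k ℕ.+ 1))
    * (((- ℕ→ℚ N) ^ℚ k)
    * (_/_ (+ (k !)) ((n ℕ.+ N ℕ.* k) !) {{(n ℕ.+ N ℕ.* k) !≢0}}
    * assocStirling1 N (n ℕ.+ N ℕ.* k) k))

binomial-term≡cauchyTerm : ∀ N n k →
  (sgn k * (hyp2F1neg 1 (suc N) (suc (suc N)) ^S k) n) * ℕ→ℚ (suc n C suc k)
    ≡ sgn n * cauchyTerm (suc N) n k
binomial-term≡cauchyTerm N n k = begin
  (sgn k * (f ^S k) n) * ℕ→ℚ (suc n C suc k)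
    ≡⟨ cong (λ x → (sgn k * x) * ℕ→ℚ (suc n C suc k)) (^S-twist (- 1ℚ) Nq f b (hyp2F1neg-1-N-[N+1] N) k n) ⟩
  (sgn k * (sgn n * (Nq ^ℚ k * (b ^S k) n))) * ℕ→ℚ (suc n C suc k)
    ≡⟨ cong (λ x → (sgn k * (sgn n * (Nq ^ℚ k * x))) * ℕ→ℚ (suc n C suc k))
            (trans (sym (^S-shift (suc N) (logTail (suc N)) (logTail-< (suc N)) k n))
                   (sym (assocStirling1-as-coefficient (suc N) M k))) ⟩
  (sgn k * (sgn n * (Nq ^ℚ k * (k!/M! * S)))) * ℕ→ℚ (suc n C suc k)
    ≡⟨ solve 6 (λ s t p q S c → (s :* (t :* (p :* (q :* S)))) :* c
                                := t :* (c :* ((s :* p) :* (q :* S))))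
               refl (sgn k) (sgn n) (Nq ^ℚ k) k!/M! S (ℕ→ℚ (suc n C suc k)) ⟩
  sgn n * (ℕ→ℚ (suc n C suc k) * ((sgn k * Nq ^ℚ k) * (k!/M! * S)))
    ≡⟨ cong₂ (λ c p → sgn n * (ℕ→ℚ c * (p * (k!/M! * S))))
             (cong₂ _C_ (ℕP.+-comm 1 n) (ℕP.+-comm 1 k)) (sym (-x^k≡sgn-k*x^k Nq)) ⟩
  sgn n * cauchyTerm (suc N) n k ∎
  where
  f b : Series
  f = hyp2F1neg 1 (suc N) (suc (suc N))
  b t = logTail (suc N) (suc N ℕ.+ t)

  Nq : ℚ
  Nq = ℕ→ℚ (suc N)

  M : ℕ
  M = n ℕ.+ suc N ℕ.* k

  k!/M! S : ℚ
  k!/M! = _/_ (+ (k !)) (M !) {{M !≢0}}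
  S = assocStirling1 (suc N) M k

  -x^k≡sgn-k*x^k : ∀ x → (- x) ^ℚ k ≡ sgn k * x ^ℚ k
  -x^k≡sgn-k*x^k x =
    trans (cong (_^ℚ k) (solve 1 (λ x → :- x := :- con 1ℚ :* x) refl x)) (^ℚ-distribʳ-* (- 1ℚ) x k)

theorem4 : (N n : ℕ) → 1 ≤ N → 1 ≤ n →
  hypCauchy N n ≡
    ((- 1ℚ) ^ℚ n) * (ℕ→ℚ (n !) *
      sumFromTo 1 n (λ k →
        ℕ→ℚ ((n ℕ.+ 1) C (k ℕ.+ 1))
          * (((- ℕ→ℚ N) ^ℚ k)
          * (_/_ (+ (k !)) ((n ℕ.+ N ℕ.* k) !) {{(n ℕ.+ N ℕ.* k) !≢0}}
          * assocStirling1 N (n ℕ.+ N ℕ.* k) k))))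
theorem4 (suc N) (suc n) _ _ = begin
  n+1! * recip1 f (suc n)
    ≡⟨ cong (n+1! *_) (trans (recip1-binomial f refl (suc n)) (∑<-head (suc n) T)) ⟩
  n+1! * (T 0 + ∑[ k < suc n ] T (suc k))
    ≡⟨ cong (λ x → n+1! * (T 0 + x)) (∑<-cong (suc n) (λ k _ → binomial-term≡cauchyTerm N (suc n) (suc k))) ⟩
  n+1! * (T 0 + ∑[ k < suc n ] (sgn (suc n) * c (suc k)))
    ≡⟨ cong (λ x → n+1! * (T 0 + x)) (∑<-distribˡ-* (suc n) (sgn (suc n)) (λ k → c (suc k))) ⟩
  n+1! * (T 0 + sgn (suc n) * ∑[ k < suc n ] c (suc k))
    ≡⟨ solve 4 (λ F b s S → F :* (con 1ℚ :* con 0ℚ :* b :+ s :* S) := s :* (F :* S))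
               refl n+1! (ℕ→ℚ (suc (suc n) C 1)) (sgn (suc n)) (∑[ k < suc n ] c (suc k)) ⟩
  sgn (suc n) * (n+1! * ∑[ k < suc n ] c (suc k))
    ≡⟨ cong (λ x → sgn (suc n) * (n+1! * x)) (sym (sumFromTo1≡∑< (suc n) c)) ⟩
  sgn (suc n) * (n+1! * sumFromTo 1 (suc n) c) ∎
  where
  f : Series
  f = hyp2F1neg 1 (suc N) (suc (suc N))

  T c : ℕ → ℚ
  T k = (sgn k * (f ^S k) (suc n)) * ℕ→ℚ (suc (suc n) C suc k)
  c = cauchyTerm (suc N) (suc n)

  n+1! : ℚ
  n+1! = ℕ→ℚ (suc n !)
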